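{- Let $m,n$ be integers with $2\leq m\leq n$, and let $K_{m,n}$ be the complete bipartite graph with parts of sizes $m$ and $n$. Then $pd(K_{m,n})=\lceil n/2\rceil$.
   Context: All graphs are simple, finite and undirected. For an edge-coloring $c$ of a graph $G$, a set $F\subseteq E(G)$ is a proper cut if $G-F$ is disconnected and any two edges of $F$ sharing an endpoint receive different colors. A proper cut $F$ separates two vertices $x,y$ if $x$ and $y$ lie in different components of $G-F$. An edge-colored graph is proper disconnected if for every pair of distinct vertices there is a proper cut separating them. For a connected graph $G$, the proper disconnection number $pd(G)$ is the minimum $k$ such that there is an edge-coloring $c:E(G)\to\{1,\dots,k\}$ making $G$ proper disconnected. -}

module Defs where

open import Level using (0ℓ)
open import Data.Nat.Base using (ℕ; _≤_)
open import Data.Fin.Base using (Fin)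
open import Data.Sum.Base using (_⊎_; inj₁; inj₂)
open import Data.Product.Base using (Σ; _×_; _,_)
open import Data.Unit.Base using (⊤)
open import Data.Empty using (⊥)
open import Relation.Nullary using (¬_)
open import Relation.Binary.PropositionalEquality using (_≡_; _≢_)

record Graph : Set₁ where
  field
    V     : Set
    Adj   : V → V → Set
    sym   : ∀ {u v} → Adj u v → Adj v u
    irref : ∀ {u} → ¬ Adj u u
open Graph public

KAdj : (m n : ℕ) → Fin m ⊎ Fin n → Fin m ⊎ Fin n → Set
KAdj m n (inj₁ _) (inj₁ _) = ⊥
KAdj m n (inj₁ _) (inj₂ _) = ⊤
KAdj m n (inj₂ _) (inj₁ _) = ⊤
KAdj m n (inj₂ _) (inj₂ _) = ⊥

KAdj-sym : ∀ m n {u v} → KAdj m n u v → KAdj m n v u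
KAdj-sym m n {inj₁ _} {inj₂ _} p = p
KAdj-sym m n {inj₂ _} {inj₁ _} p = p

KAdj-irref : ∀ m n {u} → ¬ KAdj m n u u
KAdj-irref m n {inj₁ _} ()
KAdj-irref m n {inj₂ _} ()

K : ℕ → ℕ → Graph
K m n = record
  { V = Fin m ⊎ Fin n ; Adj = KAdj m n
  ; sym = KAdj-sym m n ; irref = KAdj-irref m n }

record EdgeColoring (G : Graph) (k : ℕ) : Set where
  field
    col     : V G → V G → Fin k
    col-sym : ∀ u v → Adj G u v → col u v ≡ col v u
open EdgeColoring public

record EdgeSet (G : Graph) : Set₁ where
  field
    mem     : V G → V G → Set
    mem-sym : ∀ {u v} → mem u v → mem v u
    mem-adj : ∀ {u v} → mem u v → Adj G u v
open EdgeSet public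

data Reach (G : Graph) (F : EdgeSet G) : V G → V G → Set where
  here : ∀ {x} → Reach G F x x
  step : ∀ {x y z} → Adj G x y → ¬ mem F x y → Reach G F y z → Reach G F x z

IsProper : {G : Graph} {k : ℕ} → EdgeColoring G k → EdgeSet G → Set
IsProper {G} c F =
  ∀ u v w → mem F u v → mem F u w → v ≢ w → col c u v ≢ col c u w

ProperCutSeparating : {G : Graph} {k : ℕ} → EdgeColoring G k →
                      EdgeSet G → V G → V G → Set
ProperCutSeparating {G} c F x y = IsProper c F × ¬ Reach G F x y

ProperDisconnected : {G : Graph} {k : ℕ} → EdgeColoring G k → Set₁
ProperDisconnected {G} c =
  ∀ x y → x ≢ y → Σ (EdgeSet G) (λ F → ProperCutSeparating c F x y)

PdEq : Graph → ℕ → Set₁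
PdEq G k =
  Σ (EdgeColoring G k) ProperDisconnected ×
  (∀ j → (c : EdgeColoring G j) → ProperDisconnected c → k ≤ j)

module Submission where

-- With k = ⌈n/2⌉ each part codes injectively
-- into the doubled palette Fin k × Bool; colour uv by ρ u + ρ v mod k, where
-- ρ is the residue part of the code.  For a sign σ : V → Bool the edges with
-- ends of different signs form a cut, and it is proper as soon as (ρ, σ)
-- tells apart any two neighbours of a vertex.  Flipping the code bits along
-- a function of the residue keeps this true and can give any two distinct
-- vertices different signs.
--
-- A proper cut separating a₁ ≠ a₂
-- contains a₁b or a₂b for every common neighbour b, and properness makes
-- b ↦ (colour of that edge, which end) injective into Fin j × Bool, so the
-- number of common neighbours is at most 2j.  The choice of edges is made
-- under a double negation, removed at the end since ≤ on ℕ is decidable.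

open import Defs hiding (sym)
open import Data.Nat.Base
  using (ℕ; zero; suc; _+_; _∸_; _≤_; _<_; z≤n; s≤s; NonZero; ⌈_/2⌉)
open import Data.Nat.Properties
  using (_≤?_; +-comm; +-assoc; m+[n∸m]≡n; <⇒≤; ≤-trans; ≤-reflexive; +-monoˡ-≤;
         ⌈n/2⌉-mono; ⌊n/2⌋≤⌈n/2⌉; ⌊n/2⌋+⌈n/2⌉≡n; n≡⌈n+n/2⌉)
open import Data.Nat.DivMod using (_%_; m%n<n; %-distribˡ-+; [m+n]%n≡m%n; m<n⇒m%n≡m)
open import Data.Fin.Base using (Fin; zero; suc; toℕ; fromℕ<; inject≤)
open import Data.Fin.Properties
  using (toℕ-fromℕ<; toℕ-injective; toℕ<n; inject≤-injective; injective⇒≤; +↔⊎; _≟_)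
open import Data.Bool.Base using (Bool; true; false; not; _xor_; if_then_else_)
open import Data.Bool.Properties
  using (xor-assoc; xor-same; xor-identityʳ; xor-inverseˡ; ¬-not) renaming (_≟_ to _≟ᵇ_)
open import Data.Sum.Base using (_⊎_; inj₁; inj₂)
open import Data.Product.Base using (Σ; _×_; _,_; proj₁; proj₂)
open import Data.Unit.Base using (tt)
open import Data.Empty using (⊥-elim)
open import Function.Base using (_∘_; const)
open import Function.Bundles using (Injection; _↣_; _↔_; mk↣; mk↔ₛ′)
open import Function.Definitions using (Injective)
open import Function.Properties.Inverse using (↔⇒↣)
open import Function.Construct.Composition using (_↔-∘_; _↣-∘_)
open import Function.Construct.Symmetry using (↔-sym)
open import Relation.Nullary using (¬_; yes; no; does)
open import Relation.Nullary.Decidable using (decidable-stable; dec-true; dec-false)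
open import Relation.Nullary.Negation using (¬¬-map)
open import Relation.Binary.PropositionalEquality
  using (_≡_; _≢_; refl; sym; trans; cong; cong₂; ≢-sym; module ≡-Reasoning)

open ≡-Reasoning

module _ {k : ℕ} .{{_ : NonZero k}} where

  %-congʳ-+ : ∀ x y z → x % k ≡ y % k → (x + z) % k ≡ (y + z) % k
  %-congʳ-+ x y z x≡y = begin
    (x + z) % k           ≡⟨ %-distribˡ-+ x z k ⟩
    (x % k + z % k) % k   ≡⟨ cong (λ r → (r + z % k) % k) x≡y ⟩
    (y % k + z % k) % k   ≡⟨ %-distribˡ-+ y z k ⟨
    (y + z) % k           ∎

  +-complement : ∀ {a} b → a ≤ k → a + b + (k ∸ a) ≡ b + k
  +-complement {a} b a≤k = begin
    a + b + (k ∸ a)     ≡⟨ cong (_+ (k ∸ a)) (+-comm a b) ⟩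
    b + a + (k ∸ a)     ≡⟨ +-assoc b a (k ∸ a) ⟩
    b + (a + (k ∸ a))   ≡⟨ cong (b +_) (m+[n∸m]≡n a≤k) ⟩
    b + k               ∎

  +-cancelˡ-% : ∀ {a b b′} → a ≤ k → b < k → b′ < k →
                (a + b) % k ≡ (a + b′) % k → b ≡ b′
  +-cancelˡ-% {a} {b} {b′} a≤k b<k b′<k eq = begin
    b                      ≡⟨ m<n⇒m%n≡m b<k ⟨
    b % k                  ≡⟨ [m+n]%n≡m%n b k ⟨
    (b + k) % k            ≡⟨ cong (_% k) (+-complement b a≤k) ⟨
    (a + b + (k ∸ a)) % k  ≡⟨ %-congʳ-+ (a + b) (a + b′) (k ∸ a) eq ⟩
    (a + b′ + (k ∸ a)) % k ≡⟨ cong (_% k) (+-complement b′ a≤k) ⟩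
    (b′ + k) % k           ≡⟨ [m+n]%n≡m%n b′ k ⟩
    b′ % k                 ≡⟨ m<n⇒m%n≡m b′<k ⟩
    b′                     ∎

  infixl 6 _⊕_
  _⊕_ : Fin k → Fin k → Fin k
  a ⊕ b = fromℕ< (m%n<n (toℕ a + toℕ b) k)

  ⊕-comm : ∀ a b → a ⊕ b ≡ b ⊕ a
  ⊕-comm a b = cong (λ s → fromℕ< (m%n<n s k)) (+-comm (toℕ a) (toℕ b))

  ⊕-cancelˡ : ∀ {a b b′} → a ⊕ b ≡ a ⊕ b′ → b ≡ b′
  ⊕-cancelˡ {a} {b} {b′} eq = toℕ-injective
    (+-cancelˡ-% (<⇒≤ (toℕ<n a)) (toℕ<n b) (toℕ<n b′) (begin
      (toℕ a + toℕ b) % k   ≡⟨ toℕ-fromℕ< (m%n<n (toℕ a + toℕ b) k) ⟨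
      toℕ (a ⊕ b)           ≡⟨ cong toℕ eq ⟩
      toℕ (a ⊕ b′)          ≡⟨ toℕ-fromℕ< (m%n<n (toℕ a + toℕ b′) k) ⟩
      (toℕ a + toℕ b′) % k  ∎))

⊎↔×Bool : {A : Set} → (A ⊎ A) ↔ (A × Bool)
⊎↔×Bool {A} = mk↔ₛ′ to from to∘from from∘to
  where
  to : A ⊎ A → A × Bool
  to (inj₁ a) = a , true
  to (inj₂ a) = a , false
  from : A × Bool → A ⊎ A
  from (a , true)  = inj₁ a
  from (a , false) = inj₂ a
  to∘from : ∀ p → to (from p) ≡ p
  to∘from (a , true)  = refl
  to∘from (a , false) = refl
  from∘to : ∀ s → from (to s) ≡ s
  from∘to (inj₁ a) = refl
  from∘to (inj₂ a) = refl

palette↔ : ∀ {k} → Fin (k + k) ↔ (Fin k × Bool)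
palette↔ {k} = ⊎↔×Bool ↔-∘ +↔⊎ {k} {k}

≤⇒palette↣ : ∀ {N k} → N ≤ k + k → Fin N ↣ (Fin k × Bool)
≤⇒palette↣ N≤2k =
  ↔⇒↣ palette↔ ↣-∘ mk↣ {to = λ i → inject≤ i N≤2k}
                        (λ {i} {j} → inject≤-injective N≤2k N≤2k i j)

palette↣⇒≤ : ∀ {N k} → Fin N ↣ (Fin k × Bool) → N ≤ k + k
palette↣⇒≤ code = injective⇒≤ (Injection.injective (↔⇒↣ (↔-sym palette↔) ↣-∘ code))

flipBy : ∀ {k} → (Fin k → Bool) → Fin k × Bool → Fin k × Bool
flipBy f (c , b) = c , f c xor b

flipBy-involutive : ∀ {k} (f : Fin k → Bool) p → flipBy f (flipBy f p) ≡ p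
flipBy-involutive f (c , b) = cong (c ,_) (begin
  f c xor (f c xor b)   ≡⟨ xor-assoc (f c) (f c) b ⟨
  (f c xor f c) xor b   ≡⟨ cong (_xor b) (xor-same (f c)) ⟩
  b                     ∎)

flipBy-injective : ∀ {k} (f : Fin k → Bool) → Injective _≡_ _≡_ (flipBy f)
flipBy-injective f {p} {q} eq = begin
  p                      ≡⟨ flipBy-involutive f p ⟨
  flipBy f (flipBy f p)  ≡⟨ cong (flipBy f) eq ⟩
  flipBy f (flipBy f q)  ≡⟨ flipBy-involutive f q ⟩
  q                      ∎

sign : ∀ {k} → (Fin k → Bool) → Fin k × Bool → Bool
sign f p = proj₂ (flipBy f p)

sign-prescribed : ∀ {k} (p : Fin k × Bool) β → Σ (Fin k → Bool) λ f → sign f p ≡ β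
sign-prescribed (c , b) β = const (β xor b) , (begin
  (β xor b) xor b   ≡⟨ xor-assoc β b b ⟩
  β xor (b xor b)   ≡⟨ cong (β xor_) (xor-same b) ⟩
  β xor false       ≡⟨ xor-identityʳ β ⟩
  β                 ∎)

true≢false : true ≢ false
true≢false ()

-- Two distinct codes receive different signs under a suitable flip: if their
-- residues agree their bits differ already, otherwise flip the two residues
-- independently.
sign-separates : ∀ {k} (p q : Fin k × Bool) → p ≢ q →
                 Σ (Fin k → Bool) λ f → sign f p ≢ sign f q
sign-separates {k} (c , b) (c′ , b′) p≢q with c ≟ c′
... | yes refl = const false , λ b≡b′ → p≢q (cong (c ,_) b≡b′)
... | no c≢c′  = f , λ eq → true≢false (trans (sym f-at-c′) (trans (sym eq) f-at-c))
  where
  f : Fin k → Bool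
  f d = if does (d ≟ c) then b else not b′
  f-at-c : sign f (c , b) ≡ false
  f-at-c = trans (cong (λ t → (if t then b else not b′) xor b) (dec-true (c ≟ c) refl))
                 (xor-same b)
  f-at-c′ : sign f (c′ , b′) ≡ true
  f-at-c′ = trans (cong (λ t → (if t then b else not b′) xor b′) (dec-false (c′ ≟ c) (≢-sym c≢c′)))
                  (xor-inverseˡ b′)

signCut : (G : Graph) → (V G → Bool) → EdgeSet G
signCut G σ = record
  { mem     = λ u v → Adj G u v × σ u ≢ σ v
  ; mem-sym = λ (uv , σu≢σv) → Graph.sym G uv , ≢-sym σu≢σv
  ; mem-adj = proj₁
  }

signCut-preserves : ∀ {G} (σ : V G → Bool) {x y} → Reach G (signCut G σ) x y → σ x ≡ σ y
signCut-preserves σ here = refl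
signCut-preserves σ (step {x} {y} xy xy∉cut rest) =
  trans (decidable-stable (σ x ≟ᵇ σ y) (λ σx≢σy → xy∉cut (xy , σx≢σy)))
        (signCut-preserves σ rest)

sumColouring : ∀ {k} .{{_ : NonZero k}} (G : Graph) → (V G → Fin k) → EdgeColoring G k
sumColouring G ρ = record { col = λ u v → ρ u ⊕ ρ v ; col-sym = λ u v _ → ⊕-comm (ρ u) (ρ v) }

SeparatesNeighbours : ∀ {k} (G : Graph) → (V G → Fin k) → (V G → Bool) → Set
SeparatesNeighbours G ρ σ =
  ∀ {u v w} → Adj G u v → Adj G u w → ρ v ≡ ρ w → σ v ≡ σ w → v ≡ w

-- Under the sum colouring, the sign cut is proper when (ρ, σ) separates
-- neighbours: cut edges uv, uw have σ v = not (σ u) = σ w, and equal colours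
-- give ρ v = ρ w by cancellation.
signCut-proper : ∀ {k} .{{_ : NonZero k}} {G} (ρ : V G → Fin k) (σ : V G → Bool) →
                 SeparatesNeighbours G ρ σ → IsProper (sumColouring G ρ) (signCut G σ)
signCut-proper ρ σ separates u v w (uv , σu≢σv) (uw , σu≢σw) v≢w colours≡ =
  v≢w (separates uv uw (⊕-cancelˡ colours≡)
                       (trans (¬-not (≢-sym σu≢σv)) (sym (¬-not (≢-sym σu≢σw)))))

signCut-separating : ∀ {k} .{{_ : NonZero k}} {G} (ρ : V G → Fin k) (σ : V G → Bool) →
                     SeparatesNeighbours G ρ σ → ∀ {x y} → σ x ≢ σ y →
                     ProperCutSeparating (sumColouring G ρ) (signCut G σ) x y
signCut-separating {G = G} ρ σ separates σx≢σy =
  signCut-proper {G = G} ρ σ separates , σx≢σy ∘ signCut-preserves {G} σ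

-- In K m n all neighbours of a vertex lie in the same part, so (ρ, σ)
-- separates neighbours as soon as it is injective on each part.
bipartite-separatesNeighbours :
  ∀ {m n k} (ρ : V (K m n) → Fin k) (σ : V (K m n) → Bool) →
  Injective _≡_ _≡_ (λ i → ρ (inj₁ i) , σ (inj₁ i)) →
  Injective _≡_ _≡_ (λ t → ρ (inj₂ t) , σ (inj₂ t)) →
  SeparatesNeighbours (K m n) ρ σ
bipartite-separatesNeighbours _ _ injA _ {inj₂ _} {inj₁ _} {inj₁ _} _ _ ρ≡ σ≡ =
  cong inj₁ (injA (cong₂ _,_ ρ≡ σ≡))
bipartite-separatesNeighbours _ _ _ injB {inj₁ _} {inj₂ _} {inj₂ _} _ _ ρ≡ σ≡ =
  cong inj₂ (injB (cong₂ _,_ ρ≡ σ≡))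
bipartite-separatesNeighbours _ _ _ _ {inj₁ _} {inj₁ _} () _
bipartite-separatesNeighbours _ _ _ _ {inj₂ _} {inj₂ _} () _
bipartite-separatesNeighbours _ _ _ _ {inj₁ _} {inj₂ _} {inj₁ _} _ ()
bipartite-separatesNeighbours _ _ _ _ {inj₂ _} {inj₁ _} {inj₂ _} _ ()

K-upperBound : ∀ m n k .{{_ : NonZero k}} → m ≤ k + k → n ≤ k + k →
               Σ (EdgeColoring (K m n) k) ProperDisconnected
K-upperBound m n k m≤2k n≤2k = sumColouring (K m n) residue , separate
  where
  open Injection (≤⇒palette↣ {k = k} m≤2k) using () renaming (to to codeA; injective to codeA-injective)
  open Injection (≤⇒palette↣ {k = k} n≤2k) using () renaming (to to codeB; injective to codeB-injective)

  residue : V (K m n) → Fin k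
  residue (inj₁ i) = proj₁ (codeA i)
  residue (inj₂ t) = proj₁ (codeB t)

  signs : (Fin k → Bool) → (Fin k → Bool) → V (K m n) → Bool
  signs fA fB (inj₁ i) = sign fA (codeA i)
  signs fA fB (inj₂ t) = sign fB (codeB t)

  signs-separateNeighbours : ∀ fA fB → SeparatesNeighbours (K m n) residue (signs fA fB)
  signs-separateNeighbours fA fB = bipartite-separatesNeighbours residue (signs fA fB)
    (λ eq → codeA-injective (flipBy-injective fA eq))
    (λ eq → codeB-injective (flipBy-injective fB eq))

  different : ∀ {a b} → a ≡ true → b ≡ false → a ≢ b
  different refl refl = true≢false

  separatingFlips : ∀ x y → x ≢ y →
    Σ (Fin k → Bool) λ fA → Σ (Fin k → Bool) λ fB → signs fA fB x ≢ signs fA fB y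
  separatingFlips (inj₁ i) (inj₁ i′) x≢y
    with fA , fA-separates ← sign-separates (codeA i) (codeA i′) (x≢y ∘ cong inj₁ ∘ codeA-injective)
    = fA , const false , fA-separates
  separatingFlips (inj₂ t) (inj₂ t′) x≢y
    with fB , fB-separates ← sign-separates (codeB t) (codeB t′) (x≢y ∘ cong inj₂ ∘ codeB-injective)
    = const false , fB , fB-separates
  separatingFlips (inj₁ i) (inj₂ t) _
    with fA , x↦true ← sign-prescribed (codeA i) true
       | fB , y↦false ← sign-prescribed (codeB t) false
    = fA , fB , different x↦true y↦false
  separatingFlips (inj₂ t) (inj₁ i) _
    with fA , y↦true ← sign-prescribed (codeA i) true
       | fB , x↦false ← sign-prescribed (codeB t) false
    = fA , fB , ≢-sym (different y↦true x↦false)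

  separate : ProperDisconnected (sumColouring (K m n) residue)
  separate x y x≢y with fA , fB , σx≢σy ← separatingFlips x y x≢y =
    signCut (K m n) (signs fA fB) ,
    signCut-separating residue (signs fA fB) (signs-separateNeighbours fA fB) σx≢σy

-- If a proper edge set F joins every member of an injective family β to a₁
-- or to a₂, then N ≤ 2j: tagging each such edge with its colour and its end
-- gives an injection Fin N ↣ Fin j × Bool.
properCover-bound : ∀ {G j N} (c : EdgeColoring G j) (F : EdgeSet G) → IsProper c F →
                    (a₁ a₂ : V G) (β : Fin N → V G) → Injective _≡_ _≡_ β →
                    (∀ b → mem F a₁ (β b) ⊎ mem F a₂ (β b)) → N ≤ j + j
properCover-bound {j = j} c F F-proper a₁ a₂ β β-injective cover =
  palette↣⇒≤ (mk↣ {to = λ b → tag b (cover b)} tags-injective)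
  where
  tag : ∀ b → mem F a₁ (β b) ⊎ mem F a₂ (β b) → Fin j × Bool
  tag b (inj₁ _) = col c a₁ (β b) , true
  tag b (inj₂ _) = col c a₂ (β b) , false

  tags-differ : ∀ {b b′} → b ≢ b′ → ∀ e e′ → tag b e ≢ tag b′ e′
  tags-differ b≢b′ (inj₁ p) (inj₁ p′) eq =
    F-proper a₁ _ _ p p′ (b≢b′ ∘ β-injective) (cong proj₁ eq)
  tags-differ b≢b′ (inj₂ p) (inj₂ p′) eq =
    F-proper a₂ _ _ p p′ (b≢b′ ∘ β-injective) (cong proj₁ eq)
  tags-differ b≢b′ (inj₁ _) (inj₂ _) eq = true≢false (cong proj₂ eq)
  tags-differ b≢b′ (inj₂ _) (inj₁ _) eq = true≢false (sym (cong proj₂ eq))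

  tags-injective : Injective _≡_ _≡_ (λ b → tag b (cover b))
  tags-injective {b} {b′} eq with b ≟ b′
  ... | yes b≡b′ = b≡b′
  ... | no b≢b′  = ⊥-elim (tags-differ b≢b′ (cover b) (cover b′) eq)

¬¬-finite-choice : ∀ {N} {P : Fin N → Set} → (∀ i → ¬ ¬ P i) → ¬ ¬ (∀ i → P i)
¬¬-finite-choice {zero}  _     ¬all = ¬all λ ()
¬¬-finite-choice {suc N} ¬¬P ¬all =
  ¬¬P zero λ P₀ → ¬¬-finite-choice (¬¬P ∘ suc) λ Pₛ →
    ¬all λ { zero → P₀ ; (suc i) → Pₛ i }

-- If two distinct vertices have N common neighbours (an injective family β),
-- every proper-disconnecting j-edge-colouring has N ≤ 2j: a proper cut
-- separating a₁ from a₂ must cover every common neighbour, since otherwise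
-- a₁ (β b) a₂ is a walk avoiding it.
commonNeighbours-bound : ∀ {G j N} (c : EdgeColoring G j) → ProperDisconnected c →
                         (a₁ a₂ : V G) → a₁ ≢ a₂ →
                         (β : Fin N → V G) → Injective _≡_ _≡_ β →
                         (∀ b → Adj G a₁ (β b)) → (∀ b → Adj G a₂ (β b)) → N ≤ j + j
commonNeighbours-bound {G} {j} {N} c pd a₁ a₂ a₁≢a₂ β β-injective a₁~β a₂~β
  with F , F-proper , a₁↮a₂ ← pd a₁ a₂ a₁≢a₂ =
  decidable-stable (N ≤? j + j)
    (¬¬-map (properCover-bound c F F-proper a₁ a₂ β β-injective)
            (¬¬-finite-choice {P = Covered} covered))
  where
  Covered : Fin N → Set
  Covered b = mem F a₁ (β b) ⊎ mem F a₂ (β b)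

  covered : ∀ b → ¬ ¬ Covered b
  covered b uncovered =
    a₁↮a₂ (step (a₁~β b) (uncovered ∘ inj₁)
            (step (Graph.sym G (a₂~β b)) (uncovered ∘ inj₂ ∘ mem-sym F) here))

-- Lower bound: two vertices of the first part have all n vertices of the
-- second part as common neighbours.
K-lowerBound : ∀ {m n j} → 2 ≤ m → (c : EdgeColoring (K m n) j) → ProperDisconnected c →
               n ≤ j + j
K-lowerBound {suc (suc _)} (s≤s (s≤s _)) c pd =
  commonNeighbours-bound c pd (inj₁ zero) (inj₁ (suc zero)) (λ ())
    inj₂ (λ { refl → refl }) (λ _ → tt) (λ _ → tt)

n≤⌈n/2⌉+⌈n/2⌉ : ∀ n → n ≤ ⌈ n /2⌉ + ⌈ n /2⌉
n≤⌈n/2⌉+⌈n/2⌉ n =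
  ≤-trans (≤-reflexive (sym (⌊n/2⌋+⌈n/2⌉≡n n))) (+-monoˡ-≤ ⌈ n /2⌉ (⌊n/2⌋≤⌈n/2⌉ n))

⌈n/2⌉-least : ∀ {n j} → n ≤ j + j → ⌈ n /2⌉ ≤ j
⌈n/2⌉-least {j = j} n≤2j = ≤-trans (⌈n/2⌉-mono n≤2j) (≤-reflexive (sym (n≡⌈n+n/2⌉ j)))

⌈n/2⌉-nonZero : ∀ {n} → 1 ≤ n → NonZero ⌈ n /2⌉
⌈n/2⌉-nonZero (s≤s _) = _

theorem3p4 : (m n : ℕ) → 2 ≤ m → m ≤ n → PdEq (K m n) ⌈ n /2⌉
theorem3p4 m n 2≤m m≤n =
  K-upperBound m n ⌈ n /2⌉ {{⌈n/2⌉-nonZero 1≤n}} (≤-trans m≤n n≤2k) n≤2k ,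
  λ j c pd → ⌈n/2⌉-least (K-lowerBound 2≤m c pd)
  where
  n≤2k : n ≤ ⌈ n /2⌉ + ⌈ n /2⌉
  n≤2k = n≤⌈n/2⌉+⌈n/2⌉ n
  1≤n : 1 ≤ n
  1≤n = ≤-trans (s≤s z≤n) (≤-trans 2≤m m≤n)
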